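{- For every finite subgraph $G$ of $T_\infty$, $\lambda(G)+\partial(G)\ge\log_2(|E(G)|+1)$.
   Context: $T_\infty$ is the infinite tree whose vertex set is partitioned into levels $V_0,V_1,\dots$ such that each vertex of $V_j$ has exactly one neighbor in $V_{j+1}$ (its parent), each vertex of $V_j$ with $j\ge1$ has exactly two neighbors in $V_{j-1}$ (its children), there are no other edges, and any two vertices have a common ancestor; $V_0$ is the set of leaves. For $x\in V_k$, $T_x$ is the complete binary tree of height $k$ consisting of $x$ and its descendants. Subgraphs have no isolated vertices. $\lambda(G)$ is the maximum $k$ such that some $x\in V_k$ has $T_x\subseteq G$ ($0$ if there is none). $\partial(G)$ is the number of vertices of $G$ incident to at least one edge of $T_\infty$ not in $E(G)$. -}

module Defs where

open import Data.Nat using (ℕ; zero; suc; _+_; _*_; _∸_; _<_; ⌊_/2⌋)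
open import Data.Nat.Properties using () renaming (_≟_ to _≟ℕ_)
open import Data.Product using (_×_; _,_; Σ; ∃)
open import Data.Product.Properties using (≡-dec)
open import Data.List using (List; []; _∷_; length; filter; deduplicate; concatMap)
open import Data.List.Relation.Unary.Any using (Any; any?)
open import Relation.Binary.PropositionalEquality using (_≡_)
open import Relation.Binary using (DecidableEquality)
open import Relation.Nullary using (¬_; ¬?)
import Data.List.Membership.DecPropositional as DecMem

-- Vertex (j , n) : level j ∈ ℕ, index n ∈ ℕ.
-- The parent of (j , n) is (suc j , ⌊ n /2⌋); the children of (suc i , n)
-- are (i , 2n) and (i , 2n+1).  Any two vertices have a common ancestor
-- (iterated halving reaches 0), so this is (up to isomorphism) the tree T∞.
Vtx : Set
Vtx = ℕ × ℕ

_≟V_ : DecidableEquality Vtx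
_≟V_ = ≡-dec _≟ℕ_ _≟ℕ_

open DecMem _≟V_ using (_∈_; _∈?_) public

-- An edge of T∞ is identified with its lower endpoint (a bijection):
-- the edge e = (j , n) joins (j , n) and its parent.
Edge : Set
Edge = ℕ × ℕ

parent : Vtx → Vtx
parent (j , n) = (suc j , ⌊ n /2⌋)

ends : Edge → List Vtx
ends e = e ∷ parent e ∷ []

incident : Vtx → List Edge
incident (zero , n) = (zero , n) ∷ []
incident (suc i , n) = (suc i , n) ∷ (i , 2 * n) ∷ (i , suc (2 * n)) ∷ []

-- A finite subgraph of T∞ without isolated vertices is given by its
-- (duplicate-free) finite edge list; its vertex set is the set of endpoints.
vertices : List Edge → List Vtx
vertices G = deduplicate _≟V_ (concatMap ends G)

touchesMissing : List Edge → Vtx → Set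
touchesMissing G v = Any (λ e → ¬ (e ∈ G)) (incident v)

boundary : List Edge → ℕ
boundary G = length (filter (λ v → any? (λ e → ¬? (e ∈? G)) (incident v)) (vertices G))

ancIdx : ℕ → ℕ → ℕ
ancIdx zero m = m
ancIdx (suc d) m = ancIdx d ⌊ m /2⌋

-- T_x ⊆ G for x = (k , n): every edge of T_x (edges whose lower endpoint
-- (j , m) has j < k and ancestor at level k equal to x) belongs to G.
TreeIn : List Edge → ℕ → ℕ → Set
TreeIn G k n = ∀ j m → j < k → ancIdx (k ∸ j) m ≡ n → (j , m) ∈ G

-- some x ∈ V_k has T_x ⊆ G   (vacuously true for k = 0)
HasTree : List Edge → ℕ → Set
HasTree G k = ∃ λ n → TreeIn G k n

-- ℓ = λ(G): the maximum k such that HasTree G k (0 if there is none;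
-- since HasTree G 0 holds vacuously, this is just the maximum).
IsLambda : List Edge → ℕ → Set
IsLambda G ℓ = HasTree G ℓ × (∀ k → HasTree G k → k Data.Nat.≤ ℓ)

-- For a vertex x let G_x be the part of G inside T_x and
-- count x itself as a boundary vertex of G_x as soon as it has a child edge (as if its
-- parent edge were missing).  Then |E(G_x)| + [both child edges of x are in G] is less
-- than 2 ^ (λ(G_x) + ∂(G_x)).  Passing from the two children to x, the bounds of the two
-- branches multiply because 2^a + 2^b ≤ 2^(a+b) for a, b ≥ 1; a branch with no boundary
-- vertex either has no edges or is a complete binary tree, and in the latter case λ,
-- rather than ∂, absorbs the growth.  At a vertex x above all of G, G_x = G and x has no
-- child edge, which gives the theorem.
module Submission where

open import Defs
open import Data.Bool using (if_then_else_)
open import Data.Unit using (⊤; tt)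
open import Data.List using (List; []; _∷_; length; filter; concatMap)
open import Data.List.Membership.Propositional using (_∉_; find; lose)
open import Data.List.Membership.Propositional.Properties
  using (∈-filter⁺; ∈-filter⁻; ∈-concatMap⁺; ∈-concatMap⁻; ∈-deduplicate⁺; ∈-deduplicate⁻)
open import Data.List.Relation.Unary.All using (All; []; _∷_; lookup; tabulate)
open import Data.List.Relation.Unary.AllPairs using ([]; _∷_)
open import Data.List.Relation.Unary.Any using (here; there; any?)
open import Data.List.Relation.Unary.Unique.Propositional using (Unique)
open import Data.List.Relation.Unary.Unique.Propositional.Properties using (Unique[x∷xs]⇒x∉xs; filter⁺)
open import Data.List.Relation.Unary.Unique.DecPropositional.Properties _≟V_ using (deduplicate-!)
open import Data.List.Extrema.Nat using (argmax; f[xs]≤f[argmax])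
open import Data.Nat
  using (ℕ; zero; suc; _+_; _*_; _∸_; _^_; _⊔_; _≤_; _<_; ⌊_/2⌋; z≤n; s≤s; s≤s⁻¹; z<s; s<s)
open import Data.Nat.Properties
open import Data.Product using (_×_; _,_; proj₁; proj₂; ∃)
open import Data.Sum using (_⊎_; inj₁; inj₂; [_,_]′)
open import Function using (_∘_; flip)
open import Function.Bundles using (_⇔_; mk⇔; Equivalence)
open import Relation.Binary using (Decidable)
open import Relation.Binary.PropositionalEquality
open import Relation.Nullary using (Dec; yes; no; does; ¬_; ¬?; contradiction)
open import Relation.Nullary.Decidable using (_×-dec_; _⊎-dec_; decidable-stable)
open import Algebra.Properties.CommutativeSemigroup +-commutativeSemigroup using (interchange)

open Equivalence using (to; from)

𝟙 : ∀ {p} {P : Set p} → Dec P → ℕ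
𝟙 d = if does d then 1 else 0

𝟙-yes : ∀ {p} {P : Set p} → P → (d : Dec P) → 𝟙 d ≡ 1
𝟙-yes x (yes _) = refl
𝟙-yes x (no ¬x) = contradiction x ¬x

𝟙-no : ∀ {p} {P : Set p} → ¬ P → (d : Dec P) → 𝟙 d ≡ 0
𝟙-no ¬x (yes x) = contradiction x ¬x
𝟙-no ¬x (no _) = refl

𝟙≤1 : ∀ {p} {P : Set p} (d : Dec P) → 𝟙 d ≤ 1
𝟙≤1 (yes _) = ≤-refl
𝟙≤1 (no _) = z≤n

𝟙≡0⇒¬ : ∀ {p} {P : Set p} (d : Dec P) → 𝟙 d ≡ 0 → ¬ P
𝟙≡0⇒¬ d 𝟙≡0 x = 1+n≢0 (trans (sym (𝟙-yes x d)) 𝟙≡0)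

𝟙-cong : ∀ {p q} {P : Set p} {Q : Set q} → P ⇔ Q → (p? : Dec P) (q? : Dec Q) → 𝟙 p? ≡ 𝟙 q?
𝟙-cong P⇔Q (yes x) q? = sym (𝟙-yes (to P⇔Q x) q?)
𝟙-cong P⇔Q (no ¬x) q? = sym (𝟙-no (¬x ∘ from P⇔Q) q?)

𝟙-×-dec : ∀ {p q} {P : Set p} {Q : Set q} (p? : Dec P) (q? : Dec Q) → 𝟙 (p? ×-dec q?) ≡ 𝟙 p? * 𝟙 q?
𝟙-×-dec (yes _) (yes _) = refl
𝟙-×-dec (yes _) (no _) = refl
𝟙-×-dec (no _) _ = refl

𝟙-⊎-dec : ∀ {p q} {P : Set p} {Q : Set q} (p? : Dec P) (q? : Dec Q) → 𝟙 (p? ⊎-dec q?) ≡ 𝟙 p? ⊔ 𝟙 q?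
𝟙-⊎-dec (yes _) (yes _) = refl
𝟙-⊎-dec (yes _) (no _) = refl
𝟙-⊎-dec (no _) (yes _) = refl
𝟙-⊎-dec (no _) (no _) = refl

𝟙-¬? : ∀ {p} {P : Set p} (p? : Dec P) → 𝟙 (¬? p?) ≡ 1 ∸ 𝟙 p?
𝟙-¬? (yes _) = refl
𝟙-¬? (no _) = refl

𝟙-+ : ∀ {p q r} {P : Set p} {Q : Set q} {R : Set r} (r? : Dec R) (p? : Dec P) (q? : Dec Q) →
      R ⇔ (P ⊎ Q) → (P → ¬ Q) → 𝟙 r? ≡ 𝟙 p? + 𝟙 q?
𝟙-+ r? (yes x) q? R⇔P⊎Q P⇒¬Q =
  trans (𝟙-yes (from R⇔P⊎Q (inj₁ x)) r?) (sym (cong suc (𝟙-no (P⇒¬Q x) q?)))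
𝟙-+ r? (no ¬x) (yes y) R⇔P⊎Q P⇒¬Q = 𝟙-yes (from R⇔P⊎Q (inj₂ y)) r?
𝟙-+ r? (no ¬x) (no ¬y) R⇔P⊎Q P⇒¬Q = 𝟙-no ([ ¬x , ¬y ]′ ∘ to R⇔P⊎Q) r?

⌊2n/2⌋≡n : ∀ n → ⌊ 2 * n /2⌋ ≡ n
⌊2n/2⌋≡n zero = refl
⌊2n/2⌋≡n (suc n) rewrite *-suc 2 n = cong suc (⌊2n/2⌋≡n n)

⌊1+2n/2⌋≡n : ∀ n → ⌊ suc (2 * n) /2⌋ ≡ n
⌊1+2n/2⌋≡n zero = refl
⌊1+2n/2⌋≡n (suc n) = trans (cong (λ x → ⌊ suc x /2⌋) (*-suc 2 n)) (cong suc (⌊1+2n/2⌋≡n n))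

n≡2⌊n/2⌋⊎n≡1+2⌊n/2⌋ : ∀ n → n ≡ 2 * ⌊ n /2⌋ ⊎ n ≡ suc (2 * ⌊ n /2⌋)
n≡2⌊n/2⌋⊎n≡1+2⌊n/2⌋ zero = inj₁ refl
n≡2⌊n/2⌋⊎n≡1+2⌊n/2⌋ (suc zero) = inj₂ refl
n≡2⌊n/2⌋⊎n≡1+2⌊n/2⌋ (suc (suc n)) rewrite *-suc 2 ⌊ n /2⌋ with n≡2⌊n/2⌋⊎n≡1+2⌊n/2⌋ n
... | inj₁ e = inj₁ (cong (suc ∘ suc) e)
... | inj₂ e = inj₂ (cong (suc ∘ suc) e)

ancIdx-suc : ∀ d m → ancIdx (suc d) m ≡ ⌊ ancIdx d m /2⌋
ancIdx-suc zero m = refl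
ancIdx-suc (suc d) m = ancIdx-suc d ⌊ m /2⌋

ancIdx-≤⇒0 : ∀ d m → m ≤ d → ancIdx d m ≡ 0
ancIdx-≤⇒0 zero .zero z≤n = refl
ancIdx-≤⇒0 (suc d) zero _ = ancIdx-≤⇒0 d 0 z≤n
ancIdx-≤⇒0 (suc d) (suc m) (s≤s m≤d) = ancIdx-≤⇒0 d ⌊ suc m /2⌋ (≤-trans (s≤s⁻¹ (⌊n/2⌋<n m)) m≤d)

_⪯_ _≺_ : Vtx → Vtx → Set
(j , m) ⪯ (k , n) = j ≤ k × ancIdx (k ∸ j) m ≡ n
(j , m) ≺ (k , n) = j < k × ancIdx (k ∸ j) m ≡ n

_⪯?_ : Decidable _⪯_
(j , m) ⪯? (k , n) = j ≤? k ×-dec ancIdx (k ∸ j) m ≟ n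

_≺?_ : Decidable _≺_
(j , m) ≺? (k , n) = j <? k ×-dec ancIdx (k ∸ j) m ≟ n

≺-irrefl : ∀ {x} → ¬ x ≺ x
≺-irrefl (j<j , _) = n≮n _ j<j

⪯⇔≡⊎≺ : ∀ {x y} → x ⪯ y ⇔ (y ≡ x ⊎ x ≺ y)
⪯⇔≡⊎≺ {j , m} {k , n} = mk⇔ to′ from′
  where
  to′ : (j , m) ⪯ (k , n) → (k , n) ≡ (j , m) ⊎ (j , m) ≺ (k , n)
  to′ (j≤k , e) with m≤n⇒m<n∨m≡n j≤k
  ... | inj₁ j<k = inj₂ (j<k , e)
  ... | inj₂ refl = inj₁ (cong (j ,_) (trans (sym e) (cong (λ d → ancIdx d m) (n∸n≡0 j))))
  from′ : (k , n) ≡ (j , m) ⊎ (j , m) ≺ (k , n) → (j , m) ⪯ (k , n)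
  from′ (inj₁ refl) = ≤-refl , cong (λ d → ancIdx d m) (n∸n≡0 j)
  from′ (inj₂ (j<k , e)) = <⇒≤ j<k , e

≺-suc⇔ : ∀ {x k n} → x ≺ (suc k , n) ⇔ (x ⪯ (k , 2 * n) ⊎ x ⪯ (k , suc (2 * n)))
≺-suc⇔ {j , m} {k} {n} = mk⇔ to′ from′
  where
  up : j ≤ k → ancIdx (suc k ∸ j) m ≡ ⌊ ancIdx (k ∸ j) m /2⌋
  up j≤k = trans (cong (λ d → ancIdx d m) (+-∸-assoc 1 j≤k)) (ancIdx-suc (k ∸ j) m)
  to′ : (j , m) ≺ (suc k , n) → (j , m) ⪯ (k , 2 * n) ⊎ (j , m) ⪯ (k , suc (2 * n))
  to′ (s≤s j≤k , e) with n≡2⌊n/2⌋⊎n≡1+2⌊n/2⌋ (ancIdx (k ∸ j) m) | trans (sym (up j≤k)) e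
  ... | inj₁ e₀ | refl = inj₁ (j≤k , e₀)
  ... | inj₂ e₁ | refl = inj₂ (j≤k , e₁)
  from′ : (j , m) ⪯ (k , 2 * n) ⊎ (j , m) ⪯ (k , suc (2 * n)) → (j , m) ≺ (suc k , n)
  from′ (inj₁ (j≤k , e)) = s≤s j≤k , trans (up j≤k) (trans (cong ⌊_/2⌋ e) (⌊2n/2⌋≡n n))
  from′ (inj₂ (j≤k , e)) = s≤s j≤k , trans (up j≤k) (trans (cong ⌊_/2⌋ e) (⌊1+2n/2⌋≡n n))

⪯-2n⇒¬⪯-1+2n : ∀ {x k n} → x ⪯ (k , 2 * n) → ¬ x ⪯ (k , suc (2 * n))
⪯-2n⇒¬⪯-1+2n (_ , e) (_ , e′) = 1+n≢n (sym (trans (sym e) e′))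

Σ≺ : (Vtx → ℕ) → ℕ → ℕ → ℕ
Σ≺ f zero n = 0
Σ≺ f (suc k) n = (f (k , 2 * n) + Σ≺ f k (2 * n)) + (f (k , suc (2 * n)) + Σ≺ f k (suc (2 * n)))

Σ⪯ : (Vtx → ℕ) → ℕ → ℕ → ℕ
Σ⪯ f k n = f (k , n) + Σ≺ f k n

Σ≺-+ : ∀ {f g h} → (∀ y → f y ≡ g y + h y) → ∀ k n → Σ≺ f k n ≡ Σ≺ g k n + Σ≺ h k n
Σ≺-+ f≡g+h zero n = refl
Σ≺-+ {f} {g} {h} f≡g+h (suc k) n =
  trans (cong₂ _+_ (branch (Σ≺-+ f≡g+h k (2 * n))) (branch (Σ≺-+ f≡g+h k (suc (2 * n)))))
        (interchange (Σ⪯ g k (2 * n)) (Σ⪯ h k (2 * n)) (Σ⪯ g k (suc (2 * n))) (Σ⪯ h k (suc (2 * n))))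
  where
  branch : ∀ {c} → Σ≺ f k c ≡ Σ≺ g k c + Σ≺ h k c → Σ⪯ f k c ≡ Σ⪯ g k c + Σ⪯ h k c
  branch {c} below =
    trans (cong₂ _+_ (f≡g+h (k , c)) below) (interchange (g (k , c)) (h (k , c)) (Σ≺ g k c) (Σ≺ h k c))

Σ≺-0 : ∀ {f} → (∀ y → f y ≡ 0) → ∀ k n → Σ≺ f k n ≡ 0
Σ≺-0 f≡0 zero n = refl
Σ≺-0 {f} f≡0 (suc k) n =
  cong₂ _+_ (branch (Σ≺-0 f≡0 k (2 * n))) (branch (Σ≺-0 f≡0 k (suc (2 * n))))
  where
  branch : ∀ {c} → Σ≺ f k c ≡ 0 → Σ⪯ f k c ≡ 0
  branch {c} below = cong₂ _+_ (f≡0 (k , c)) below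

Σ≺-δ : ∀ a k n → Σ≺ (λ y → 𝟙 (y ≟V a)) k n ≡ 𝟙 (a ≺? (k , n))
Σ≺-δ a zero n = sym (𝟙-no (λ ()) (a ≺? (zero , n)))
Σ≺-δ a (suc k) n = begin
  Σ⪯ δ k (2 * n) + Σ⪯ δ k (suc (2 * n))
    ≡⟨ cong₂ _+_ (branch (Σ≺-δ a k (2 * n))) (branch (Σ≺-δ a k (suc (2 * n)))) ⟩
  𝟙 (a ⪯? (k , 2 * n)) + 𝟙 (a ⪯? (k , suc (2 * n)))
    ≡⟨ 𝟙-+ (a ≺? (suc k , n)) (a ⪯? (k , 2 * n)) (a ⪯? (k , suc (2 * n)))
           ≺-suc⇔ (⪯-2n⇒¬⪯-1+2n {n = n}) ⟨
  𝟙 (a ≺? (suc k , n)) ∎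
  where
  open ≡-Reasoning
  δ : Vtx → ℕ
  δ y = 𝟙 (y ≟V a)
  branch : ∀ {c} → Σ≺ δ k c ≡ 𝟙 (a ≺? (k , c)) → Σ⪯ δ k c ≡ 𝟙 (a ⪯? (k , c))
  branch {c} below = trans (cong (δ (k , c) +_) below)
    (sym (𝟙-+ (a ⪯? (k , c)) ((k , c) ≟V a) (a ≺? (k , c)) ⪯⇔≡⊎≺ (λ { refl → ≺-irrefl })))

length≡Σ≺ : ∀ {L k n} → Unique L → All (_≺ (k , n)) L → length L ≡ Σ≺ (λ y → 𝟙 (y ∈? L)) k n
length≡Σ≺ {[]} {k} {n} [] [] = sym (Σ≺-0 (λ y → 𝟙-no (λ ()) (y ∈? [])) k n)
length≡Σ≺ {a ∷ L} {k} {n} (a∉L ∷ uL) (a≺v ∷ L≺v) = sym (begin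
  Σ≺ (λ y → 𝟙 (y ∈? a ∷ L)) k n
    ≡⟨ Σ≺-+ split k n ⟩
  Σ≺ (λ y → 𝟙 (y ≟V a)) k n + Σ≺ (λ y → 𝟙 (y ∈? L)) k n
    ≡⟨ cong₂ _+_ (trans (Σ≺-δ a k n) (𝟙-yes a≺v (a ≺? (k , n)))) (sym (length≡Σ≺ uL L≺v)) ⟩
  suc (length L) ∎)
  where
  open ≡-Reasoning
  split : ∀ y → 𝟙 (y ∈? a ∷ L) ≡ 𝟙 (y ≟V a) + 𝟙 (y ∈? L)
  split y = 𝟙-+ (y ∈? a ∷ L) (y ≟V a) (y ∈? L)
                (mk⇔ (λ { (here e) → inj₁ e ; (there p) → inj₂ p }) [ here , there ]′)
                (λ { refl y∈L → Unique[x∷xs]⇒x∉xs (a∉L ∷ uL) y∈L })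

suc[m+n]<o+p : ∀ {m n o p} → m < o → n < p → suc (m + n) < o + p
suc[m+n]<o+p {m} {n} {o} {p} m<o n<p = subst (_≤ o + p) (cong suc (+-suc m n)) (+-mono-≤ m<o n<p)

suc[x+y]<2^c : ∀ {x y a b c} → x < 2 ^ a → y < 2 ^ b → a < c → b < c → suc (x + y) < 2 ^ c
suc[x+y]<2^c {c = suc c} x<2^a y<2^b (s≤s a≤c) (s≤s b≤c) =
  <-≤-trans (suc[m+n]<o+p x<2^a y<2^b)
            (+-mono-≤ (^-monoʳ-≤ 2 a≤c) (≤-trans (^-monoʳ-≤ 2 b≤c) (≤-reflexive (sym (+-identityʳ _)))))

x<2^a⇒1+x<2^[1+a] : ∀ {x a} → x < 2 ^ a → suc x < 2 ^ suc a
x<2^a⇒1+x<2^[1+a] {x} {a} x<2^a =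
  subst (λ z → suc z < 2 ^ suc a) (+-identityʳ x) (suc[x+y]<2^c x<2^a (m^n>0 2 a) (n<1+n a) (n<1+n a))

x+y<2^[L+[p+q]] : ∀ {x y L p q} → x < 2 ^ (L + p) → y < 2 ^ (L + q) →
          (p ≡ 0 → x ≡ 0) → (q ≡ 0 → y ≡ 0) → x + y < 2 ^ (L + (p + q))
x+y<2^[L+[p+q]] {p = zero} x< y< x≡0 _ rewrite x≡0 refl = y<
x+y<2^[L+[p+q]] {x} {L = L} {p = suc p} {q = zero} x< y< _ y≡0
  rewrite y≡0 refl | +-identityʳ x | +-identityʳ p = x<
x+y<2^[L+[p+q]] {L = L} {p = suc p} {q = suc q} x< y< _ _ =
  <-trans (n<1+n _) (suc[x+y]<2^c x< y< (+-monoʳ-< L (s<s (m<m+n p z<s))) (+-monoʳ-< L (m<n+m (suc q) z<s)))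

-- p, p′: boundary counts of two sibling branches at level k whose parent edges are both
-- present; h: the height of the first one, L: that of the parent.
sibling-exponent< : ∀ {k L h p p′} → h ≤ L → (p ≡ 0 → h ≡ k) → (p ≢ 0 → h < k) →
                    (p′ ≡ 0 → k ≤ L) → (p ≡ 0 → p′ ≡ 0 → L ≡ suc k) → h + suc p < L + suc (p + p′)
sibling-exponent< {p = zero} {zero} _ h≡k _ _ L≡1+k rewrite h≡k refl | L≡1+k refl refl = n<1+n _
sibling-exponent< {p = zero} {suc _} h≤L _ _ _ _ = +-mono-≤-< h≤L (s<s z<s)
sibling-exponent< {L = L} {p = suc p} {zero} _ _ h<k k≤L _ =
  +-mono-<-≤ (<-≤-trans (h<k (λ ())) (k≤L refl)) (≤-reflexive (cong (suc ∘ suc) (sym (+-identityʳ p))))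
sibling-exponent< {p = suc p} {suc _} h≤L _ _ _ _ = +-mono-≤-< h≤L (s<s (m<m+n (suc p) z<s))

size : Edge → ℕ
size (j , m) = j + m

≺-root : ∀ {j m k} → j + m < k → (j , m) ≺ (k , 0)
≺-root {j} {m} {k} j+m<k =
  m+n≤o⇒m≤o (suc j) j+m<k ,
  ancIdx-≤⇒0 (k ∸ j) m (m+n≤o⇒m≤o∸n m (subst (_≤ k) (+-comm j m) (<⇒≤ j+m<k)))

module _ (G : List Edge) where

  edge : Vtx → ℕ
  edge v = 𝟙 (v ∈? G)

  touchesMissing? : ∀ v → Dec (touchesMissing G v)
  touchesMissing? v = any? (λ e → ¬? (e ∈? G)) (incident v)

  ∂G : List Vtx
  ∂G = filter touchesMissing? (vertices G)

  onBoundary : Vtx → ℕ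
  onBoundary v = 𝟙 (v ∈? ∂G)

  BothChildren SomeChild : ℕ → ℕ → Set
  BothChildren k n = (k , 2 * n) ∈ G × (k , suc (2 * n)) ∈ G
  SomeChild k n = (k , 2 * n) ∈ G ⊎ (k , suc (2 * n)) ∈ G

  bothChildren? : ∀ k n → Dec (BothChildren k n)
  bothChildren? k n = (k , 2 * n) ∈? G ×-dec (k , suc (2 * n)) ∈? G

  someChild? : ∀ k n → Dec (SomeChild k n)
  someChild? k n = (k , 2 * n) ∈? G ⊎-dec (k , suc (2 * n)) ∈? G

  bothChildren someChild missingChild : ℕ → ℕ → ℕ
  bothChildren zero n = 0
  bothChildren (suc k) n = edge (k , 2 * n) * edge (k , suc (2 * n))
  someChild zero n = 0
  someChild (suc k) n = edge (k , 2 * n) ⊔ edge (k , suc (2 * n))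
  missingChild zero n = 0
  missingChild (suc k) n = 1 ∸ bothChildren (suc k) n

  ends⇒vertex : ∀ {u e} → e ∈ G → u ∈ ends e → u ∈ vertices G
  ends⇒vertex e∈G u∈e = ∈-deduplicate⁺ _≟V_ (∈-concatMap⁺ ends (lose e∈G u∈e))

  vertex⇒ends : ∀ {u} → u ∈ vertices G → ∃ λ e → e ∈ G × u ∈ ends e
  vertex⇒ends u∈V = find (∈-concatMap⁻ ends (∈-deduplicate⁻ _≟V_ (concatMap ends G) u∈V))

  ∂G⁻ : ∀ {v} → v ∈ ∂G → v ∈ vertices G × touchesMissing G v
  ∂G⁻ = ∈-filter⁻ touchesMissing?

  ∂G⁺ : ∀ {v} → v ∈ vertices G → touchesMissing G v → v ∈ ∂G
  ∂G⁺ = ∈-filter⁺ touchesMissing?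

  onBoundary-∈ : ∀ {k n} → (k , n) ∈ G → onBoundary (k , n) ≡ missingChild k n
  onBoundary-∈ {zero} {n} v∈G = 𝟙-no (λ v∈∂ → notMissing (proj₂ (∂G⁻ v∈∂))) ((zero , n) ∈? ∂G)
    where
    notMissing : ¬ touchesMissing G (zero , n)
    notMissing (here v∉G) = v∉G v∈G
  onBoundary-∈ {suc k} {n} v∈G = begin
    𝟙 ((suc k , n) ∈? ∂G)
      ≡⟨ 𝟙-cong (mk⇔ to′ from′) ((suc k , n) ∈? ∂G) (¬? (bothChildren? k n)) ⟩
    𝟙 (¬? (bothChildren? k n))
      ≡⟨ 𝟙-¬? (bothChildren? k n) ⟩
    1 ∸ 𝟙 (bothChildren? k n)
      ≡⟨ cong (1 ∸_) (𝟙-×-dec ((k , 2 * n) ∈? G) ((k , suc (2 * n)) ∈? G)) ⟩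
    missingChild (suc k) n ∎
    where
    open ≡-Reasoning
    to′ : (suc k , n) ∈ ∂G → ¬ BothChildren k n
    to′ v∈∂ (c₀∈G , c₁∈G) with proj₂ (∂G⁻ v∈∂)
    ... | here v∉G = v∉G v∈G
    ... | there (here c₀∉G) = c₀∉G c₀∈G
    ... | there (there (here c₁∉G)) = c₁∉G c₁∈G
    from′ : ¬ BothChildren k n → (suc k , n) ∈ ∂G
    from′ ¬both = ∂G⁺ (ends⇒vertex v∈G (here refl)) missing
      where
      missing : touchesMissing G (suc k , n)
      missing with (k , 2 * n) ∈? G
      ... | yes c₀∈G = there (there (here (λ c₁∈G → ¬both (c₀∈G , c₁∈G))))
      ... | no c₀∉G = there (here c₀∉G)

  onBoundary-∉ : ∀ {k n} → (k , n) ∉ G → onBoundary (k , n) ≡ someChild k n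
  onBoundary-∉ {zero} {n} v∉G = 𝟙-no notVertex ((zero , n) ∈? ∂G)
    where
    notVertex : (zero , n) ∉ ∂G
    notVertex v∈∂ with vertex⇒ends (proj₁ (∂G⁻ v∈∂))
    ... | e , e∈G , here refl = v∉G e∈G
    ... | e , e∈G , there (here ())
  onBoundary-∉ {suc k} {n} v∉G =
    trans (𝟙-cong (mk⇔ to′ from′) ((suc k , n) ∈? ∂G) (someChild? k n))
          (𝟙-⊎-dec ((k , 2 * n) ∈? G) ((k , suc (2 * n)) ∈? G))
    where
    to′ : (suc k , n) ∈ ∂G → SomeChild k n
    to′ v∈∂ with vertex⇒ends (proj₁ (∂G⁻ v∈∂))
    ... | e , e∈G , here refl = contradiction e∈G v∉G
    ... | (k , m) , e∈G , there (here refl) with n≡2⌊n/2⌋⊎n≡1+2⌊n/2⌋ m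
    ...   | inj₁ m≡2n = inj₁ (subst (λ i → (k , i) ∈ G) m≡2n e∈G)
    ...   | inj₂ m≡1+2n = inj₂ (subst (λ i → (k , i) ∈ G) m≡1+2n e∈G)
    from′ : SomeChild k n → (suc k , n) ∈ ∂G
    from′ (inj₁ c₀∈G) =
      ∂G⁺ (ends⇒vertex c₀∈G (there (here (cong (suc k ,_) (sym (⌊2n/2⌋≡n n)))))) (here v∉G)
    from′ (inj₂ c₁∈G) =
      ∂G⁺ (ends⇒vertex c₁∈G (there (here (cong (suc k ,_) (sym (⌊1+2n/2⌋≡n n)))))) (here v∉G)

  Full : ℕ → ℕ → Set
  Full zero n = ⊤
  Full (suc k) n = BothChildren k n × Full k (2 * n) × Full k (suc (2 * n))

  -- Opaque, so that `with full? k n` also abstracts it inside `height k n`.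
  opaque
    full? : ∀ k n → Dec (Full k n)
    full? zero n = yes tt
    full? (suc k) n = bothChildren? k n ×-dec full? k (2 * n) ×-dec full? k (suc (2 * n))

  Full⇒TreeIn : ∀ k n → Full k n → TreeIn G k n
  Full⇒TreeIn zero n _ j m () _
  Full⇒TreeIn (suc k) n ((c₀∈G , c₁∈G) , F₀ , F₁) j m j<k anc≡n
    with to ≺-suc⇔ (j<k , anc≡n)
  ... | inj₁ x⪯c₀ with to ⪯⇔≡⊎≺ x⪯c₀
  ...   | inj₁ refl = c₀∈G
  ...   | inj₂ (j<k′ , anc≡2n) = Full⇒TreeIn k (2 * n) F₀ j m j<k′ anc≡2n
  Full⇒TreeIn (suc k) n ((c₀∈G , c₁∈G) , F₀ , F₁) j m j<k anc≡n
      | inj₂ x⪯c₁ with to ⪯⇔≡⊎≺ x⪯c₁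
  ...   | inj₁ refl = c₁∈G
  ...   | inj₂ (j<k′ , anc≡1+2n) = Full⇒TreeIn k (suc (2 * n)) F₁ j m j<k′ anc≡1+2n

  height : ℕ → ℕ → ℕ
  height zero n = 0
  height (suc k) n = if does (full? (suc k) n) then suc k else height k (2 * n) ⊔ height k (suc (2 * n))

  height≤level : ∀ k n → height k n ≤ k
  height≤level zero n = z≤n
  height≤level (suc k) n with full? (suc k) n
  ... | yes _ = ≤-refl
  ... | no _ = m≤n⇒m≤1+n (⊔-lub (height≤level k (2 * n)) (height≤level k (suc (2 * n))))

  height-full : ∀ {k n} → Full k n → height k n ≡ k
  height-full {zero} _ = refl
  height-full {suc k} {n} F with full? (suc k) n
  ... | yes _ = refl
  ... | no ¬F = contradiction F ¬F

  height-notFull : ∀ {k n} → ¬ Full k n → height k n < k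
  height-notFull {zero} ¬F = contradiction tt ¬F
  height-notFull {suc k} {n} ¬F with full? (suc k) n
  ... | yes F = contradiction F ¬F
  ... | no _ = s≤s (⊔-lub (height≤level k (2 * n)) (height≤level k (suc (2 * n))))

  height-child₀ : ∀ k n → height k (2 * n) ≤ height (suc k) n
  height-child₀ k n with full? (suc k) n
  ... | yes _ = m≤n⇒m≤1+n (height≤level k (2 * n))
  ... | no _ = m≤m⊔n _ _

  height-child₁ : ∀ k n → height k (suc (2 * n)) ≤ height (suc k) n
  height-child₁ k n with full? (suc k) n
  ... | yes _ = m≤n⇒m≤1+n (height≤level k (suc (2 * n)))
  ... | no _ = m≤n⊔m _ _

  height-tree : ∀ k n → HasTree G (height k n)
  height-tree zero n = n , λ _ _ ()
  height-tree (suc k) n with full? (suc k) n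
  ... | yes F = n , Full⇒TreeIn (suc k) n F
  ... | no _ with ⊔-sel (height k (2 * n)) (height k (suc (2 * n)))
  ...   | inj₁ ⊔≡h₀ rewrite ⊔≡h₀ = height-tree k (2 * n)
  ...   | inj₂ ⊔≡h₁ rewrite ⊔≡h₁ = height-tree k (suc (2 * n))

  Full⇒noBoundary : ∀ {k c} → (k , c) ∈ G → Full k c → Σ⪯ onBoundary k c ≡ 0
  Full⇒noBoundary {zero} c∈G _ = cong (_+ 0) (onBoundary-∈ c∈G)
  Full⇒noBoundary {suc k} {c} c∈G ((c₀∈G , c₁∈G) , F₀ , F₁) =
    cong₂ _+_ (trans (onBoundary-∈ c∈G) noneMissing)
              (cong₂ _+_ (Full⇒noBoundary c₀∈G F₀) (Full⇒noBoundary c₁∈G F₁))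
    where
    noneMissing : missingChild (suc k) c ≡ 0
    noneMissing rewrite 𝟙-yes c₀∈G ((k , 2 * c) ∈? G) | 𝟙-yes c₁∈G ((k , suc (2 * c)) ∈? G) = refl

  noBoundary⇒Full : ∀ {k c} → (k , c) ∈ G → Σ⪯ onBoundary k c ≡ 0 → Full k c
  noBoundary⇒Full {zero} _ _ = tt
  noBoundary⇒Full {suc k} {c} c∈G ∂≡0 =
    both , noBoundary⇒Full (proj₁ both) ∂₀≡0 , noBoundary⇒Full (proj₂ both) ∂₁≡0
    where
    below≡0 : Σ⪯ onBoundary k (2 * c) + Σ⪯ onBoundary k (suc (2 * c)) ≡ 0
    below≡0 = m+n≡0⇒n≡0 (onBoundary (suc k , c)) ∂≡0
    ∂₀≡0 : Σ⪯ onBoundary k (2 * c) ≡ 0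
    ∂₀≡0 = m+n≡0⇒m≡0 (Σ⪯ onBoundary k (2 * c)) below≡0
    ∂₁≡0 : Σ⪯ onBoundary k (suc (2 * c)) ≡ 0
    ∂₁≡0 = m+n≡0⇒n≡0 (Σ⪯ onBoundary k (2 * c)) below≡0
    both : BothChildren k c
    both = decidable-stable (bothChildren? k c) (𝟙≡0⇒¬ (¬? (bothChildren? k c)) (begin
      𝟙 (¬? (bothChildren? k c))  ≡⟨ 𝟙-¬? (bothChildren? k c) ⟩
      1 ∸ 𝟙 (bothChildren? k c)   ≡⟨ cong (1 ∸_) (𝟙-×-dec ((k , 2 * c) ∈? G) ((k , suc (2 * c)) ∈? G)) ⟩
      missingChild (suc k) c      ≡⟨ onBoundary-∈ c∈G ⟨
      onBoundary (suc k , c)      ≡⟨ m+n≡0⇒m≡0 (onBoundary (suc k , c)) ∂≡0 ⟩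
      0                           ∎))
      where open ≡-Reasoning

  noBoundary⇒noEdges : ∀ {k c} → (k , c) ∉ G → Σ⪯ onBoundary k c ≡ 0 → Σ≺ edge k c ≡ 0
  noBoundary⇒noEdges {zero} _ _ = refl
  noBoundary⇒noEdges {suc k} {c} c∉G ∂≡0 =
    cong₂ _+_ (branch (n≤0⇒n≡0 (≤-trans (m≤m⊔n _ _) noChild)) ∂₀≡0)
              (branch (n≤0⇒n≡0 (≤-trans (m≤n⊔m _ _) noChild)) ∂₁≡0)
    where
    noChild : someChild (suc k) c ≤ 0
    noChild = ≤-reflexive (trans (sym (onBoundary-∉ c∉G)) (m+n≡0⇒m≡0 (onBoundary (suc k , c)) ∂≡0))
    below≡0 : Σ⪯ onBoundary k (2 * c) + Σ⪯ onBoundary k (suc (2 * c)) ≡ 0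
    below≡0 = m+n≡0⇒n≡0 (onBoundary (suc k , c)) ∂≡0
    ∂₀≡0 : Σ⪯ onBoundary k (2 * c) ≡ 0
    ∂₀≡0 = m+n≡0⇒m≡0 (Σ⪯ onBoundary k (2 * c)) below≡0
    ∂₁≡0 : Σ⪯ onBoundary k (suc (2 * c)) ≡ 0
    ∂₁≡0 = m+n≡0⇒n≡0 (Σ⪯ onBoundary k (2 * c)) below≡0
    branch : ∀ {c′} → edge (k , c′) ≡ 0 → Σ⪯ onBoundary k c′ ≡ 0 → Σ⪯ edge k c′ ≡ 0
    branch {c′} c′∉G ∂′≡0 =
      cong₂ _+_ c′∉G (noBoundary⇒noEdges (𝟙≡0⇒¬ ((k , c′) ∈? G) c′∉G) ∂′≡0)

  -- The invariant of the header: `someChild k n + Σ≺ onBoundary k n` is ∂ of the part of G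
  -- below (k , n) when (k , n) is counted as a boundary vertex.
  SubtreeBound : ℕ → ℕ → Set
  SubtreeBound k n = bothChildren k n + Σ≺ edge k n < 2 ^ (height k n + (someChild k n + Σ≺ onBoundary k n))

  branch-∉ : ∀ {k c L} → (k , c) ∉ G → height k c ≤ L → SubtreeBound k c →
             Σ≺ edge k c < 2 ^ (L + Σ⪯ onBoundary k c)
  branch-∉ {k} {c} c∉G h≤L bound rewrite onBoundary-∉ c∉G =
    <-≤-trans (≤-<-trans (m≤n+m _ (bothChildren k c)) bound) (^-monoʳ-≤ 2 (+-monoˡ-≤ _ h≤L))

  branch-∈ : ∀ {k c L} → (k , c) ∈ G → height k c ≤ L → SubtreeBound k c →
             suc (Σ≺ edge k c) < 2 ^ (L + suc (Σ⪯ onBoundary k c))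
  branch-∈ {zero} {c} {L} c∈G _ _ rewrite onBoundary-∈ c∈G = ^-monoʳ-≤ 2 (m≤n+m 1 L)
  branch-∈ {suc k} {c} {L} c∈G h≤L bound rewrite onBoundary-∈ c∈G =
    step (𝟙≤1 ((k , 2 * c) ∈? G)) (𝟙≤1 ((k , suc (2 * c)) ∈? G)) bound
    where
    notBoth : ∀ {x s ∂} → s ≤ 1 → x < 2 ^ (height (suc k) c + (s + ∂)) → suc x < 2 ^ (L + suc (suc ∂))
    notBoth {x} {s} {∂} s≤1 x< = subst (λ e → suc x < 2 ^ e) (sym (+-suc L (suc ∂)))
      (x<2^a⇒1+x<2^[1+a] {a = L + suc ∂}
        (<-≤-trans x< (^-monoʳ-≤ 2 (+-mono-≤ h≤L (+-monoˡ-≤ ∂ s≤1)))))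
    step : ∀ {u₀ u₁ x ∂} → u₀ ≤ 1 → u₁ ≤ 1 → u₀ * u₁ + x < 2 ^ (height (suc k) c + (u₀ ⊔ u₁ + ∂)) →
           suc x < 2 ^ (L + suc (1 ∸ u₀ * u₁ + ∂))
    step z≤n u₁≤1 x< = notBoth u₁≤1 x<
    step (s≤s z≤n) z≤n x< = notBoth ≤-refl x<
    step (s≤s z≤n) (s≤s z≤n) x< = <-≤-trans x< (^-monoʳ-≤ 2 (+-monoˡ-≤ _ h≤L))

  -- `SubtreeBound (suc k) n` unfolds to this statement at the two membership tests;
  -- taking them as arguments lets every case compute `edge` at the children.
  children-bound : ∀ {k n L} (d₀ : Dec ((k , 2 * n) ∈ G)) (d₁ : Dec ((k , suc (2 * n)) ∈ G)) →
    height k (2 * n) ≤ L → height k (suc (2 * n)) ≤ L → (Full (suc k) n → L ≡ suc k) →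
    SubtreeBound k (2 * n) → SubtreeBound k (suc (2 * n)) →
    𝟙 d₀ * 𝟙 d₁ + ((𝟙 d₀ + Σ≺ edge k (2 * n)) + (𝟙 d₁ + Σ≺ edge k (suc (2 * n))))
      < 2 ^ (L + (𝟙 d₀ ⊔ 𝟙 d₁ + (Σ⪯ onBoundary k (2 * n) + Σ⪯ onBoundary k (suc (2 * n)))))
  children-bound {k} {n} {L} (no c₀∉G) (no c₁∉G) h₀≤L h₁≤L _ B₀ B₁ =
    x+y<2^[L+[p+q]] {L = L} (branch-∉ c₀∉G h₀≤L B₀) (branch-∉ c₁∉G h₁≤L B₁)
            (noBoundary⇒noEdges c₀∉G) (noBoundary⇒noEdges c₁∉G)
  children-bound {L = L} (yes c₀∈G) (no c₁∉G) h₀≤L h₁≤L _ B₀ B₁ =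
    x+y<2^[L+[p+q]] {L = L} (branch-∈ c₀∈G h₀≤L B₀) (branch-∉ c₁∉G h₁≤L B₁)
                    (λ ()) (noBoundary⇒noEdges c₁∉G)
  children-bound {k} {n} {L} (no c₀∉G) (yes c₁∈G) h₀≤L h₁≤L _ B₀ B₁ =
    subst (λ e → Σ≺ edge k (2 * n) + suc (Σ≺ edge k (suc (2 * n))) < 2 ^ (L + e))
          (+-suc (Σ⪯ onBoundary k (2 * n)) (Σ⪯ onBoundary k (suc (2 * n))))
      (x+y<2^[L+[p+q]] {L = L} (branch-∉ c₀∉G h₀≤L B₀) (branch-∈ c₁∈G h₁≤L B₁)
                       (noBoundary⇒noEdges c₀∉G) (λ ()))
  children-bound {k} {n} {L} (yes c₀∈G) (yes c₁∈G) h₀≤L h₁≤L full⇒L≡1+k B₀ B₁ =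
    suc[x+y]<2^c (branch-∈ c₀∈G ≤-refl B₀) (branch-∈ c₁∈G ≤-refl B₁)
           (sibling-exponent< h₀≤L height-full₀ height-notFull₀ sibling₁ bothFull)
           (subst (λ e → height k (suc (2 * n)) + suc (Σ⪯ onBoundary k (suc (2 * n))) < L + suc e)
                  (+-comm (Σ⪯ onBoundary k (suc (2 * n))) (Σ⪯ onBoundary k (2 * n)))
             (sibling-exponent< h₁≤L height-full₁ height-notFull₁ sibling₀ (flip bothFull)))
    where
    height-full₀ : Σ⪯ onBoundary k (2 * n) ≡ 0 → height k (2 * n) ≡ k
    height-full₀ = height-full ∘ noBoundary⇒Full c₀∈G
    height-full₁ : Σ⪯ onBoundary k (suc (2 * n)) ≡ 0 → height k (suc (2 * n)) ≡ k
    height-full₁ = height-full ∘ noBoundary⇒Full c₁∈G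
    height-notFull₀ : Σ⪯ onBoundary k (2 * n) ≢ 0 → height k (2 * n) < k
    height-notFull₀ ∂≢0 = height-notFull (∂≢0 ∘ Full⇒noBoundary c₀∈G)
    height-notFull₁ : Σ⪯ onBoundary k (suc (2 * n)) ≢ 0 → height k (suc (2 * n)) < k
    height-notFull₁ ∂≢0 = height-notFull (∂≢0 ∘ Full⇒noBoundary c₁∈G)
    sibling₀ : Σ⪯ onBoundary k (2 * n) ≡ 0 → k ≤ L
    sibling₀ ∂≡0 = subst (_≤ L) (height-full₀ ∂≡0) h₀≤L
    sibling₁ : Σ⪯ onBoundary k (suc (2 * n)) ≡ 0 → k ≤ L
    sibling₁ ∂≡0 = subst (_≤ L) (height-full₁ ∂≡0) h₁≤L
    bothFull : Σ⪯ onBoundary k (2 * n) ≡ 0 → Σ⪯ onBoundary k (suc (2 * n)) ≡ 0 → L ≡ suc k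
    bothFull ∂₀≡0 ∂₁≡0 =
      full⇒L≡1+k ((c₀∈G , c₁∈G) , noBoundary⇒Full c₀∈G ∂₀≡0 , noBoundary⇒Full c₁∈G ∂₁≡0)

  subtree-bound : ∀ k n → SubtreeBound k n
  subtree-bound zero n = s≤s z≤n
  subtree-bound (suc k) n =
    children-bound {k} {n} ((k , 2 * n) ∈? G) ((k , suc (2 * n)) ∈? G) (height-child₀ k n) (height-child₁ k n)
                   height-full (subtree-bound k (2 * n)) (subtree-bound k (suc (2 * n)))

  maxSize : ℕ
  maxSize = size (argmax size (0 , 0) G)

  rootLevel : ℕ
  rootLevel = suc (suc maxSize)

  size<rootLevel : ∀ {e} → e ∈ G → suc (size e) < rootLevel
  size<rootLevel e∈G = s≤s (s≤s (lookup (f[xs]≤f[argmax] (0 , 0) G) e∈G))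

  vertex≺root : ∀ {u} → u ∈ vertices G → u ≺ (rootLevel , 0)
  vertex≺root u∈V with vertex⇒ends u∈V
  ... | e , e∈G , here refl = ≺-root (<-trans (n<1+n _) (size<rootLevel e∈G))
  ... | (j , m) , e∈G , there (here refl) =
    ≺-root (≤-<-trans (s≤s (+-monoʳ-≤ j (⌊n/2⌋≤n m))) (size<rootLevel e∈G))

  root-noChild : someChild rootLevel 0 ≡ 0
  root-noChild = cong₂ _⊔_ (𝟙-no tooLow ((suc maxSize , 0) ∈? G)) (𝟙-no tooLow ((suc maxSize , 1) ∈? G))
    where
    tooLow : ∀ {i} → (suc maxSize , i) ∉ G
    tooLow {i} e∈G = n≮n (suc maxSize) (≤-<-trans (m≤m+n (suc maxSize) i) (s≤s⁻¹ (size<rootLevel e∈G)))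

  length≡Σ≺edge : Unique G → length G ≡ Σ≺ edge rootLevel 0
  length≡Σ≺edge uniqueG =
    length≡Σ≺ uniqueG (tabulate (λ e∈G → vertex≺root (ends⇒vertex e∈G (here refl))))

  boundary≡Σ≺onBoundary : boundary G ≡ Σ≺ onBoundary rootLevel 0
  boundary≡Σ≺onBoundary =
    length≡Σ≺ (filter⁺ touchesMissing? (deduplicate-! (concatMap ends G)))
              (tabulate (vertex≺root ∘ proj₁ ∘ ∂G⁻))

lemma3p12 : (G : List Edge) → Unique G → (ℓ : ℕ) → IsLambda G ℓ →
    length G + 1 ≤ 2 ^ (ℓ + boundary G)
lemma3p12 G uniqueG ℓ (_ , ℓ-max) = begin
  length G + 1                                ≡⟨ +-comm (length G) 1 ⟩
  suc (length G)                              ≡⟨ cong suc (length≡Σ≺edge G uniqueG) ⟩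
  suc (Σ≺ (edge G) H 0)                       ≤⟨ s≤s (m≤n+m _ (bothChildren G H 0)) ⟩
  suc (bothChildren G H 0 + Σ≺ (edge G) H 0)  ≤⟨ subtree-bound G H 0 ⟩
  2 ^ (height G H 0 + (someChild G H 0 + ∂))  ≡⟨ cong (λ s → 2 ^ (height G H 0 + (s + ∂))) (root-noChild G) ⟩
  2 ^ (height G H 0 + ∂)                      ≤⟨ ^-monoʳ-≤ 2 (+-mono-≤ height≤ℓ ∂≤boundary) ⟩
  2 ^ (ℓ + boundary G)                        ∎
  where
  open ≤-Reasoning
  H : ℕ
  H = rootLevel G
  ∂ : ℕ
  ∂ = Σ≺ (onBoundary G) H 0
  height≤ℓ : height G H 0 ≤ ℓ
  height≤ℓ = ℓ-max _ (height-tree G H 0)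
  ∂≤boundary : ∂ ≤ boundary G
  ∂≤boundary = ≤-reflexive (sym (boundary≡Σ≺onBoundary G))
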